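{- Let $P$ be a random interval order on $n$ elements. Then with high probability the number of pairwise comparisons needed (in the worst case) to sort $n$ keys whose true order is a linear extension of $P$ is at least $c\,n\log_e n\,(1+o(1))$, where one can take $c=\frac{1}{2\log_e 2}\approx 0.72135$.
   Context: A random interval order is generated by drawing $2n$ independent uniform random numbers $X_1,\dots,X_n,Y_1,\dots,Y_n$ in $[0,1]$, forming the closed intervals $I_j$ with endpoints $X_j$ and $Y_j$, and declaring $I_i\prec I_j$ iff the maximum of $I_i$ is less than the minimum of $I_j$. "With high probability" means with probability tending to $1$ as $n\to\infty$. -}

module Defs where

open import Data.Nat using (ℕ; zero; suc; _+_; _*_; _^_; _<_; _≤_; _<ᵇ_; _⊔_; _⊓_)
open import Data.Bool using (if_then_else_)
open import Data.Fin using (Fin; toℕ; _↑ˡ_; _↑ʳ_)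
open import Data.Vec using (Vec; lookup)
open import Data.Product using (Σ; _×_)
open import Relation.Binary.PropositionalEquality using (_≡_)

-- Outcome of the random experiment: the relative order (ranks) of the 2n
-- numbers X_1..X_n,Y_1..Y_n.  Since ties have probability 0 and the 2n
-- numbers are i.i.d. uniform, the rank vector is a uniformly random
-- permutation of Fin (n + n), and the interval order depends only on it.
Outcome : ℕ → Set
Outcome n = Vec (Fin (n + n)) (n + n)

IsPerm : (n : ℕ) → Outcome n → Set
IsPerm n σ = ∀ (i j : Fin (n + n)) → lookup σ i ≡ lookup σ j → i ≡ j

X Y : ∀ {n} → Outcome n → Fin n → ℕ
X {n} σ j = toℕ (lookup σ (j ↑ˡ n))
Y {n} σ j = toℕ (lookup σ (n ↑ʳ j))

Prec : ∀ {n} → Outcome n → Fin n → Fin n → Set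
Prec σ i j = (X σ i ⊔ Y σ i) < (X σ j ⊓ Y σ j)

-- A true order on the n keys: an injective rank function ρ
-- (key a is smaller than key b iff ρ a < ρ b).
IsLinearOrder : ∀ {n} → (Fin n → Fin n) → Set
IsLinearOrder {n} ρ = ∀ (a b : Fin n) → ρ a ≡ ρ b → a ≡ b

IsLinExt : ∀ {n} → Outcome n → (Fin n → Fin n) → Set
IsLinExt σ ρ = IsLinearOrder ρ × (∀ i j → Prec σ i j → toℕ (ρ i) < toℕ (ρ j))

-- Comparison-based sorting algorithms = decision trees.
-- node a b l r : compare keys a and b; continue in l if a < b, else r.
-- leaf o : output the claimed order (rank of each key).
data DTree (n : ℕ) : Set where
  leaf : (Fin n → Fin n) → DTree n
  node : Fin n → Fin n → DTree n → DTree n → DTree n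

run : ∀ {n} → DTree n → (Fin n → Fin n) → (Fin n → Fin n)
run (leaf o) ρ = o
run (node a b l r) ρ = if toℕ (ρ a) <ᵇ toℕ (ρ b) then run l ρ else run r ρ

cost : ∀ {n} → DTree n → (Fin n → Fin n) → ℕ
cost (leaf o) ρ = 0
cost (node a b l r) ρ = suc (if toℕ (ρ a) <ᵇ toℕ (ρ b) then cost l ρ else cost r ρ)

Sorts : ∀ {n} → Outcome n → DTree n → Set
Sorts σ T = ∀ ρ → IsLinExt σ ρ → ∀ a → run T ρ a ≡ ρ a

-- "Bad" event for parameter m (ε = 1/m): some algorithm sorts all linear
-- extensions using, in the worst case, k comparisons with
-- k < (1 - 1/m) · n log₂ n / 2 = (1 - 1/m) · n ln n / (2 ln 2),
-- i.e. 2^(2·k·m) < n^((m-1)·n).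
FastSortable : (n : ℕ) → ℕ → Outcome n → Set
FastSortable n m σ =
  Σ (DTree n) λ T → Sorts σ T ×
    (∀ ρ → IsLinExt σ ρ → 2 ^ (2 * cost T ρ * m) < n ^ ((m Data.Nat.∸ 1) * n))

-- A multiple of W lying inside several intervals makes them pairwise incomparable. Cut
-- [0, 2n) into windows of width W ≈ n / D: any reordering of the intervals that start in
-- the same window and reach past its right end gives a linear extension, so with g_w such
-- ("covered") intervals in window w there are ∏ g_w! ≥ t ^ ∑ (g_w ∸ t) distinct extensions.
-- Every uncovered interval is short (length < W). Averaged over all (2n)! rank vectors the
-- number of short intervals is at most 2W, so by Markov's inequality all but a fraction
-- 1/(q+1) of the outcomes have at most n/8 of them. For those, taking t = n / R gives at
-- least n ^ (n/2) linear extensions, and a comparison tree telling them apart has depth at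
-- least log₂ of that, i.e. (n/2) log₂ n = n ln n / (2 ln 2).

{-# OPTIONS --safe #-}
module Submission where

open import Defs
open import Data.Nat using (ℕ; suc; _*_; _+_; _≤_; _!)
open import Data.List using (List; length)
open import Data.List.Membership.Propositional using (_∈_)
open import Data.List.Relation.Unary.Unique.Propositional using (Unique)
open import Data.Product using (Σ; _×_)

open import Level using (Level)
open import Function using (_∘_)
open import Data.Empty using (⊥; ⊥-elim)
open import Data.Unit using (⊤; tt)
open import Data.Bool.Base using (true; false; T)
open import Data.Sum using (inj₁; inj₂)
open import Data.Product using (_,_; proj₁; proj₂; ∃-syntax)
import Data.Product as Product using (map₁; map₂)
open import Relation.Nullary using (¬_; Dec; yes; no; ¬?; T?; _×-dec_)
open import Relation.Binary.Definitions using (tri<; tri≈; tri>)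
open import Relation.Binary.PropositionalEquality
  using (_≡_; _≢_; _≗_; refl; sym; trans; cong; cong₂; subst; subst₂; module ≡-Reasoning)
open import Function.Definitions using (Injective)

open import Data.Nat.Base
  using (zero; pred; _∸_; _^_; _<_; _<ᵇ_; _/_; _%_; _⊔_; _⊓_; ∣_-_∣; z≤n; s≤s; s≤s⁻¹; z<s; s<s; s<s⁻¹;
         NonZero; >-nonZero; >-nonZero⁻¹)
open import Data.Nat.Properties
open import Data.Nat.DivMod using (m≡m%n+[m/n]*n; m%n<n; m/n*n≤m; m<n*o⇒m/o<n; m≥n⇒m/n>0)
open import Data.Nat.Solver using (module +-*-Solver)
open import Data.Nat.ListAction using (sum)
open import Data.Nat.ListAction.Properties using (sum-++)
open import Algebra.Properties.Semiring.Sum +-*-semiring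
  using (sum-syntax; sum-remove; ∑-comm; ∑-distrib-+; *-distribˡ-sum)

open import Data.Fin as Fin using (Fin; toℕ; punchIn; punchOut; fromℕ<; _↑ˡ_; _↑ʳ_)
open import Data.Fin.Properties
  using (toℕ-injective; toℕ<n; toℕ-↑ˡ; toℕ-↑ʳ; toℕ-fromℕ<; fromℕ<-toℕ; punchIn-injective; punchInᵢ≢i; punchIn-punchOut)
  renaming (suc-injective to Fin-suc-injective)
open import Data.Vec.Base as Vec using (Vec; lookup; []; _∷_)
open import Data.Vec.Properties using (∷-injective; lookup-map; tabulate∘lookup; tabulate-cong; lookup∘tabulate)

open import Data.List.Base using ([]; _∷_; _++_; map; filter; tabulate; allFin; cartesianProductWith; cartesianProduct)
open import Data.List.Properties using (map-++; map-∘; map-cong; length-++; length-map; length-tabulate)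
open import Data.List.Extrema.Nat using (argmax; argmax-sel; f[⊥]≤f[argmax]; f[xs]≤f[argmax])
open import Data.List.Membership.Propositional.Properties
  using (∈-allFin; ∈-map⁻; ∈-filter⁺; ∈-cartesianProductWith⁺; ∈-cartesianProductWith⁻; ∈-cartesianProduct⁻)
open import Data.List.Relation.Unary.Any using (here; there)
open import Data.List.Relation.Unary.All as All using (All; []; _∷_)
open import Data.List.Relation.Unary.All.Properties as All using (all-filter)
open import Data.List.Relation.Unary.AllPairs using (AllPairs; []; _∷_)
import Data.List.Relation.Unary.AllPairs.Properties as AllPairs
import Data.List.Relation.Unary.Unique.Propositional.Properties as Unique

𝟙 : ∀ {p} {P : Set p} → Dec P → ℕ
𝟙 (yes _) = 1
𝟙 (no _) = 0

private variable
  p q : Level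
  P Q : Set p

𝟙≤1 : (P? : Dec P) → 𝟙 P? ≤ 1
𝟙≤1 (yes _) = ≤-refl
𝟙≤1 (no _) = z≤n

𝟙-yes : P → (P? : Dec P) → 𝟙 P? ≡ 1
𝟙-yes _ (yes _) = refl
𝟙-yes p (no ¬p) = ⊥-elim (¬p p)

𝟙-no : ¬ P → (P? : Dec P) → 𝟙 P? ≡ 0
𝟙-no ¬p (yes p) = ⊥-elim (¬p p)
𝟙-no _ (no _) = refl

𝟙-mono : (P → Q) → (P? : Dec P) (Q? : Dec Q) → 𝟙 P? ≤ 𝟙 Q?
𝟙-mono _ (no _) _ = z≤n
𝟙-mono _ (yes _) (yes _) = ≤-refl
𝟙-mono P⇒Q (yes p) (no ¬q) = ⊥-elim (¬q (P⇒Q p))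

𝟙-cong : (P → Q) → (Q → P) → (P? : Dec P) (Q? : Dec Q) → 𝟙 P? ≡ 𝟙 Q?
𝟙-cong P⇒Q Q⇒P P? Q? = ≤-antisym (𝟙-mono P⇒Q P? Q?) (𝟙-mono Q⇒P Q? P?)

∑-const : ∀ {K} c → ∑[ i < K ] c ≡ K * c
∑-const {zero} c = refl
∑-const {suc K} c = cong (c +_) (∑-const {K} c)

∑-zero : ∀ {K} {f : Fin K → ℕ} → (∀ i → f i ≡ 0) → ∑[ i < K ] f i ≡ 0
∑-zero {zero} f≡0 = refl
∑-zero {suc K} f≡0 = cong₂ _+_ (f≡0 Fin.zero) (∑-zero (f≡0 ∘ Fin.suc))

∑-mono-≤ : ∀ {K} {f g : Fin K → ℕ} → (∀ i → f i ≤ g i) → ∑[ i < K ] f i ≤ ∑[ i < K ] g i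
∑-mono-≤ {zero} f≤g = z≤n
∑-mono-≤ {suc K} f≤g = +-mono-≤ (f≤g Fin.zero) (∑-mono-≤ (f≤g ∘ Fin.suc))

∑-mono-< : ∀ {K} {f g : Fin K → ℕ} → (∀ i → f i ≤ g i) → ∀ k → f k < g k →
           ∑[ i < K ] f i < ∑[ i < K ] g i
∑-mono-< f≤g Fin.zero fk<gk = +-mono-<-≤ fk<gk (∑-mono-≤ (f≤g ∘ Fin.suc))
∑-mono-< f≤g (Fin.suc k) fk<gk = +-mono-≤-< (f≤g Fin.zero) (∑-mono-< (f≤g ∘ Fin.suc) k fk<gk)

∑-cong : ∀ {K} {f g : Fin K → ℕ} → (∀ i → f i ≡ g i) → ∑[ i < K ] f i ≡ ∑[ i < K ] g i
∑-cong {zero} f≗g = refl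
∑-cong {suc K} f≗g = cong₂ _+_ (f≗g Fin.zero) (∑-cong (f≗g ∘ Fin.suc))

∑-𝟙-window : ∀ {K} {P : ℕ → Set} (P? : ∀ u → Dec (P u)) lo L →
             (∀ {u} → P u → lo ≤ u × u < lo + L) → ∑[ u < K ] 𝟙 (P? (toℕ u)) ≤ L
∑-𝟙-window {zero} P? lo L inWindow = z≤n
∑-𝟙-window {suc K} {P} P? lo L inWindow with P? 0
... | no _ = ∑-𝟙-window {K} (P? ∘ suc) (pred lo) L (shift lo inWindow)
  where
  shift : ∀ lo → (∀ {u} → P u → lo ≤ u × u < lo + L) → ∀ {u} → P (suc u) → pred lo ≤ u × u < pred lo + L
  shift zero inW Psu = z≤n , <⇒≤ (proj₂ (inW Psu))
  shift (suc lo) inW Psu with inW Psu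
  ... | s≤s lo≤u , s≤s u<lo+L = lo≤u , u<lo+L
... | yes P0 = start lo L inWindow (inWindow P0)
  where
  start : ∀ lo L → (∀ {u} → P u → lo ≤ u × u < lo + L) → lo ≤ 0 × 0 < lo + L →
          1 + ∑[ u < K ] 𝟙 (P? (suc (toℕ u))) ≤ L
  start zero (suc L) inW _ = s≤s (∑-𝟙-window {K} (P? ∘ suc) 0 L (λ Psu → z≤n , s≤s⁻¹ (proj₂ (inW Psu))))

∑-𝟙-≟ : ∀ {K} (v : Fin K) → ∑[ w < K ] 𝟙 (v Fin.≟ w) ≡ 1
∑-𝟙-≟ {suc K} Fin.zero = cong suc (∑-zero {K} λ w → 𝟙-no (λ ()) (Fin.zero Fin.≟ Fin.suc w))
∑-𝟙-≟ {suc K} (Fin.suc v) =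
  trans (∑-cong {K} λ w → 𝟙-cong Fin-suc-injective (cong Fin.suc) (Fin.suc v Fin.≟ Fin.suc w) (v Fin.≟ w)) (∑-𝟙-≟ v)

∑-𝟙-×-≟ : ∀ {p} {P : Set p} {K} (P? : Dec P) (v : Fin K) → ∑[ w < K ] 𝟙 (P? ×-dec v Fin.≟ w) ≡ 𝟙 P?
∑-𝟙-×-≟ {K = K} (yes p) v = trans (∑-cong {K} λ w → 𝟙-cong proj₂ (p ,_) (yes p ×-dec v Fin.≟ w) (v Fin.≟ w)) (∑-𝟙-≟ v)
∑-𝟙-×-≟ {K = K} (no ¬p) v = ∑-zero {K} λ w → 𝟙-no (¬p ∘ proj₁) (no ¬p ×-dec v Fin.≟ w)

private variable
  A B C : Set

sumOver : (A → ℕ) → List A → ℕ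
sumOver f xs = sum (map f xs)

infixl 10 sumOver
syntax sumOver (λ x → e) xs = ∑[ x ∈ xs ] e

sumOver-++ : ∀ (f : A → ℕ) xs ys → ∑[ x ∈ xs ++ ys ] f x ≡ ∑[ x ∈ xs ] f x + ∑[ x ∈ ys ] f x
sumOver-++ f xs ys = trans (cong sum (map-++ f xs ys)) (sum-++ (map f xs) (map f ys))

sumOver-mono-≤ : ∀ {f g : A → ℕ} xs → (∀ x → f x ≤ g x) → ∑[ x ∈ xs ] f x ≤ ∑[ x ∈ xs ] g x
sumOver-mono-≤ [] f≤g = z≤n
sumOver-mono-≤ (x ∷ xs) f≤g = +-mono-≤ (f≤g x) (sumOver-mono-≤ xs f≤g)

sumOver-const : ∀ c (xs : List A) → ∑[ x ∈ xs ] c ≡ length xs * c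
sumOver-const c [] = refl
sumOver-const c (x ∷ xs) = cong (c +_) (sumOver-const c xs)

sumOver-∑ : ∀ {K} (h : A → Fin K → ℕ) xs → ∑[ x ∈ xs ] ∑[ i < K ] h x i ≡ ∑[ i < K ] ∑[ x ∈ xs ] h x i
sumOver-∑ {K = K} h [] = sym (∑-zero {K} λ _ → refl)
sumOver-∑ h (x ∷ xs) = trans (cong (∑[ i < _ ] h x i +_) (sumOver-∑ h xs)) (sym (∑-distrib-+ (h x) _))

sumOver-tabulate : ∀ {K} (f : A → ℕ) (g : Fin K → A) → ∑[ x ∈ tabulate g ] f x ≡ ∑[ i < K ] f (g i)
sumOver-tabulate {K = zero} f g = refl
sumOver-tabulate {K = suc K} f g = cong (f (g Fin.zero) +_) (sumOver-tabulate f (g ∘ Fin.suc))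

sumOver-cartesianProductWith : ∀ (f : C → ℕ) (g : A → B → C) xs ys →
  ∑[ z ∈ cartesianProductWith g xs ys ] f z ≡ ∑[ x ∈ xs ] ∑[ y ∈ ys ] f (g x y)
sumOver-cartesianProductWith f g [] ys = refl
sumOver-cartesianProductWith f g (x ∷ xs) ys = begin
  ∑[ z ∈ map (g x) ys ++ cartesianProductWith g xs ys ] f z
    ≡⟨ sumOver-++ f (map (g x) ys) _ ⟩
  ∑[ z ∈ map (g x) ys ] f z + ∑[ z ∈ cartesianProductWith g xs ys ] f z
    ≡⟨ cong₂ _+_ (cong sum (sym (map-∘ ys))) (sumOver-cartesianProductWith f g xs ys) ⟩
  ∑[ y ∈ ys ] f (g x y) + ∑[ x ∈ xs ] ∑[ y ∈ ys ] f (g x y) ∎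
  where open ≡-Reasoning

markov : ∀ {P : A → Set} (P? : ∀ x → Dec (P x)) (f : A → ℕ) U → (∀ {x} → P x → U ≤ f x) →
         ∀ xs → length (filter P? xs) * U ≤ ∑[ x ∈ xs ] f x
markov P? f U P⇒U≤f [] = z≤n
markov P? f U P⇒U≤f (x ∷ xs) with P? x
... | yes Px = +-mono-≤ (P⇒U≤f Px) (markov P? f U P⇒U≤f xs)
... | no _ = ≤-trans (markov P? f U P⇒U≤f xs) (m≤n+m _ (f x))

length-cartesianProductWith : ∀ (g : A → B → C) xs ys →
  length (cartesianProductWith g xs ys) ≡ length xs * length ys
length-cartesianProductWith g [] ys = refl
length-cartesianProductWith g (x ∷ xs) ys =
  trans (length-++ (map (g x) ys)) (cong₂ _+_ (length-map (g x) ys) (length-cartesianProductWith g xs ys))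

length-filter-∁ : ∀ {P : A → Set} (P? : ∀ x → Dec (P x)) xs →
  length xs ≡ length (filter P? xs) + length (filter (¬? ∘ P?) xs)
length-filter-∁ P? [] = refl
length-filter-∁ P? (x ∷ xs) with P? x
... | yes _ = cong suc (length-filter-∁ P? xs)
... | no _ = trans (cong suc (length-filter-∁ P? xs)) (sym (+-suc _ _))

unique⇒pairwise-distinct : ∀ {R : A → A → Set} {xs} → Unique xs →
  (∀ {x y} → x ∈ xs → y ∈ xs → R x y → x ≡ y) → AllPairs (λ x y → ¬ R x y) xs
unique⇒pairwise-distinct [] _ = []
unique⇒pairwise-distinct (x∉xs ∷ unique) R⇒≡ =
  All.tabulate (λ y∈ Rxy → All.lookup x∉xs y∈ (R⇒≡ (here refl) (there y∈) Rxy))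
  ∷ unique⇒pairwise-distinct unique (λ x∈ y∈ → R⇒≡ (there x∈) (there y∈))

lookup-ext : ∀ {K} {u v : Vec A K} → (∀ i → lookup u i ≡ lookup v i) → u ≡ v
lookup-ext {u = u} {v} u≗v = trans (sym (tabulate∘lookup u)) (trans (tabulate-cong u≗v) (tabulate∘lookup v))

-- Enumerating permutations

Perm : ℕ → Set
Perm M = Vec (Fin M) M

prepend : ∀ {M} → Fin (suc M) → Perm M → Perm (suc M)
prepend x τ = x ∷ Vec.map (punchIn x) τ

allPerms : ∀ M → List (Perm M)
allPerms zero = [] ∷ []
allPerms (suc M) = cartesianProductWith prepend (allFin (suc M)) (allPerms M)

prepend-injective : ∀ {M} {x y : Fin (suc M)} {τ τ' : Perm M} →
                    prepend x τ ≡ prepend y τ' → x ≡ y × τ ≡ τ'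
prepend-injective {x = x} {τ = τ} {τ'} eq with ∷-injective eq
... | refl , map-eq = refl , lookup-ext λ i →
  punchIn-injective x _ _
    (trans (sym (lookup-map i (punchIn x) τ)) (trans (cong (λ v → lookup v i) map-eq) (lookup-map i (punchIn x) τ')))

allPerms⁺ : ∀ M → Unique (allPerms M)
allPerms⁺ zero = [] ∷ []
allPerms⁺ (suc M) = Unique.cartesianProductWith⁺ prepend prepend-injective (Unique.allFin⁺ (suc M)) (allPerms⁺ M)

length-allPerms : ∀ M → length (allPerms M) ≡ M !
length-allPerms zero = refl
length-allPerms (suc M) =
  trans (length-cartesianProductWith prepend (allFin (suc M)) (allPerms M))
        (cong₂ _*_ (length-tabulate {n = suc M} (λ i → i)) (length-allPerms M))

∈-allPerms : ∀ {M} (σ : Perm M) → Injective _≡_ _≡_ (lookup σ) → σ ∈ allPerms M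
∈-allPerms {zero} [] _ = here refl
∈-allPerms {suc M} (x ∷ ρ) inj =
  subst (_∈ allPerms (suc M)) (cong (x ∷_) (lookup-ext λ i → trans (lookup-map i (punchIn x) τ) (punchIn-τ i)))
  (∈-cartesianProductWith⁺ prepend (∈-allFin x) (∈-allPerms τ τ-inj))
  where
  x≢ρ : ∀ i → x ≢ lookup ρ i
  x≢ρ i eq with inj {Fin.zero} {Fin.suc i} eq
  ... | ()
  τ : Perm M
  τ = Vec.tabulate (λ i → punchOut (x≢ρ i))
  punchIn-τ : ∀ i → punchIn x (lookup τ i) ≡ lookup ρ i
  punchIn-τ i = trans (cong (punchIn x) (lookup∘tabulate _ i)) (punchIn-punchOut (x≢ρ i))
  τ-inj : Injective _≡_ _≡_ (lookup τ)
  τ-inj {i} {j} eq = Fin-suc-injective (inj (trans (sym (punchIn-τ i)) (trans (cong (punchIn x) eq) (punchIn-τ j))))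

allPerms-injective : ∀ {M} {σ : Perm M} → σ ∈ allPerms M → Injective _≡_ _≡_ (lookup σ)
allPerms-injective {zero} {[]} _ {()}
allPerms-injective {suc M} σ∈ with ∈-cartesianProductWith⁻ prepend (allFin (suc M)) (allPerms M) σ∈
... | x , τ , _ , τ∈ , refl = inj
  where
  lookup-tail : ∀ i → lookup (prepend x τ) (Fin.suc i) ≡ punchIn x (lookup τ i)
  lookup-tail i = lookup-map i (punchIn x) τ
  inj : Injective _≡_ _≡_ (lookup (prepend x τ))
  inj {Fin.zero} {Fin.zero} _ = refl
  inj {Fin.zero} {Fin.suc j} eq = ⊥-elim (punchInᵢ≢i x (lookup τ j) (sym (trans eq (lookup-tail j))))
  inj {Fin.suc i} {Fin.zero} eq = ⊥-elim (punchInᵢ≢i x (lookup τ i) (trans (sym (lookup-tail i)) eq))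
  inj {Fin.suc i} {Fin.suc j} eq = cong Fin.suc (allPerms-injective τ∈
    (punchIn-injective x _ _ (trans (sym (lookup-tail i)) (trans eq (lookup-tail j)))))

allPerms-surjective : ∀ {M} {σ : Perm M} → σ ∈ allPerms M → ∀ v → ∃[ a ] lookup σ a ≡ v
allPerms-surjective {suc M} σ∈ v with ∈-cartesianProductWith⁻ prepend (allFin (suc M)) (allPerms M) σ∈
... | x , τ , _ , τ∈ , refl with x Fin.≟ v
...   | yes refl = Fin.zero , refl
...   | no x≢v with allPerms-surjective τ∈ (punchOut x≢v)
...     | a , τa≡ =
  Fin.suc a , trans (lookup-map a (punchIn x) τ) (trans (cong (punchIn x) τa≡) (punchIn-punchOut x≢v))

StrictlyMonotone : ∀ {s} → (Fin s → Fin s) → Set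
StrictlyMonotone f = ∀ {a b} → a Fin.< b → f a Fin.< f b

strictlyMonotone⇒inflationary : ∀ {s} {f : Fin s → Fin s} → StrictlyMonotone f → ∀ a → toℕ a ≤ toℕ (f a)
strictlyMonotone⇒inflationary {s} {f} mono a =
  subst (λ b → toℕ a ≤ toℕ (f b)) (fromℕ<-toℕ a (toℕ<n a)) (inflationaryAt (toℕ a) (toℕ<n a))
  where
  inflationaryAt : ∀ k (k<s : k < s) → k ≤ toℕ (f (fromℕ< k<s))
  inflationaryAt zero _ = z≤n
  inflationaryAt (suc k) k<s = ≤-<-trans (inflationaryAt k (<-trans (n<1+n k) k<s))
    (mono (subst₂ _<_ (sym (toℕ-fromℕ< _)) (sym (toℕ-fromℕ< k<s)) (n<1+n k)))

allPerms-order-rigid : ∀ {s} {π π' : Perm s} → π ∈ allPerms s → π' ∈ allPerms s →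
  (∀ {a b} → lookup π a Fin.< lookup π b → lookup π' a Fin.< lookup π' b) →
  (∀ {a b} → lookup π' a Fin.< lookup π' b → lookup π a Fin.< lookup π b) → π ≡ π'
allPerms-order-rigid {s} {π} {π'} π∈ π'∈ π⇒π' π'⇒π = lookup-ext λ a →
  toℕ-injective (trans (cong (toℕ ∘ lookup π) (sym (inverse'-lookup a))) (g-id (lookup π' a)))
  where
  inverse inverse' : Fin s → Fin s
  inverse v = proj₁ (allPerms-surjective π∈ v)
  inverse' v = proj₁ (allPerms-surjective π'∈ v)
  lookup-inverse : ∀ v → lookup π (inverse v) ≡ v
  lookup-inverse v = proj₂ (allPerms-surjective π∈ v)
  lookup-inverse' : ∀ v → lookup π' (inverse' v) ≡ v
  lookup-inverse' v = proj₂ (allPerms-surjective π'∈ v)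
  inverse-lookup : ∀ a → inverse (lookup π a) ≡ a
  inverse-lookup a = allPerms-injective π∈ (lookup-inverse (lookup π a))
  inverse'-lookup : ∀ a → inverse' (lookup π' a) ≡ a
  inverse'-lookup a = allPerms-injective π'∈ (lookup-inverse' (lookup π' a))
  f g : Fin s → Fin s
  f v = lookup π' (inverse v)
  g v = lookup π (inverse' v)
  f-mono : StrictlyMonotone f
  f-mono {u} {v} u<v = π⇒π' (subst₂ Fin._<_ (sym (lookup-inverse u)) (sym (lookup-inverse v)) u<v)
  g-mono : StrictlyMonotone g
  g-mono {u} {v} u<v = π'⇒π (subst₂ Fin._<_ (sym (lookup-inverse' u)) (sym (lookup-inverse' v)) u<v)
  f∘g : ∀ v → f (g v) ≡ v
  f∘g v = trans (cong (lookup π') (inverse-lookup (inverse' v))) (lookup-inverse' v)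
  g-id : ∀ v → toℕ (g v) ≡ toℕ v
  g-id v = ≤-antisym (subst (λ w → toℕ (g v) ≤ toℕ w) (f∘g v) (strictlyMonotone⇒inflationary f-mono (g v)))
                     (strictlyMonotone⇒inflationary g-mono v)

sumOver-allPerms : ∀ M (f : Perm (suc M) → ℕ) →
  ∑[ σ ∈ allPerms (suc M) ] f σ ≡ ∑[ x < suc M ] ∑[ τ ∈ allPerms M ] f (prepend x τ)
sumOver-allPerms M f =
  trans (sumOver-cartesianProductWith f prepend (allFin (suc M)) (allPerms M))
        (sumOver-tabulate _ (λ (x : Fin (suc M)) → x))

∑-∑-punchIn : ∀ {M} (f : Fin (suc M) → ℕ) →
  ∑[ x < suc M ] ∑[ u < M ] f (punchIn x u) ≡ M * ∑[ x < suc M ] f x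
∑-∑-punchIn {M} f = +-cancelˡ-≡ S _ _ (begin
  S + ∑[ x < suc M ] ∑[ u < M ] f (punchIn x u)   ≡⟨ ∑-distrib-+ f (λ x → ∑[ u < M ] f (punchIn x u)) ⟨
  ∑[ x < suc M ] (f x + ∑[ u < M ] f (punchIn x u)) ≡⟨ ∑-cong (λ x → sum-remove {i = x} f) ⟨
  ∑[ x < suc M ] S                                 ≡⟨ ∑-const {suc M} S ⟩
  S + M * S                                        ∎)
  where
  open ≡-Reasoning
  S = ∑[ x < suc M ] f x

∑-allPerms-lookup : ∀ M (d : Fin (suc M)) (f : Fin (suc M) → ℕ) →
  ∑[ σ ∈ allPerms (suc M) ] f (lookup σ d) ≡ M ! * ∑[ x < suc M ] f x
∑-allPerms-lookup M Fin.zero f = begin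
  ∑[ σ ∈ allPerms (suc M) ] f (lookup σ Fin.zero)   ≡⟨ sumOver-allPerms M _ ⟩
  ∑[ x < suc M ] ∑[ τ ∈ allPerms M ] f x           ≡⟨ ∑-cong (λ x → sumOver-const (f x) (allPerms M)) ⟩
  ∑[ x < suc M ] (length (allPerms M) * f x)       ≡⟨ ∑-cong (λ x → cong (_* f x) (length-allPerms M)) ⟩
  ∑[ x < suc M ] (M ! * f x)                       ≡⟨ *-distribˡ-sum (M !) f ⟨
  M ! * ∑[ x < suc M ] f x                         ∎
  where open ≡-Reasoning
∑-allPerms-lookup (suc M) (Fin.suc d) f = begin
  ∑[ σ ∈ allPerms (suc (suc M)) ] f (lookup σ (Fin.suc d))
    ≡⟨ sumOver-allPerms (suc M) _ ⟩
  ∑[ x < suc (suc M) ] ∑[ τ ∈ allPerms (suc M) ] f (lookup (Vec.map (punchIn x) τ) d)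
    ≡⟨ ∑-cong (λ x → cong sum (map-cong (λ τ → cong f (lookup-map d (punchIn x) τ)) (allPerms (suc M)))) ⟩
  ∑[ x < suc (suc M) ] ∑[ τ ∈ allPerms (suc M) ] f (punchIn x (lookup τ d))
    ≡⟨ ∑-cong (λ x → ∑-allPerms-lookup M d (f ∘ punchIn x)) ⟩
  ∑[ x < suc (suc M) ] (M ! * ∑[ u < suc M ] f (punchIn x u))
    ≡⟨ *-distribˡ-sum (M !) (λ x → ∑[ u < suc M ] f (punchIn x u)) ⟨
  M ! * ∑[ x < suc (suc M) ] ∑[ u < suc M ] f (punchIn x u)
    ≡⟨ cong (M ! *_) (∑-∑-punchIn f) ⟩
  M ! * (suc M * ∑[ x < suc (suc M) ] f x)
    ≡⟨ *-assoc (M !) (suc M) _ ⟨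
  M ! * suc M * ∑[ x < suc (suc M) ] f x
    ≡⟨ cong (_* ∑[ x < suc (suc M) ] f x) (*-comm (M !) (suc M)) ⟩
  suc M ! * ∑[ x < suc (suc M) ] f x ∎
  where open ≡-Reasoning

-- Close pairs in a random permutation

close : ℕ → ℕ → ℕ → ℕ
close W u v = 𝟙 (∣ u - v ∣ <? W)

toℕ≤toℕ-punchIn : ∀ {M} (x : Fin (suc M)) (u : Fin M) → toℕ u ≤ toℕ (punchIn x u)
toℕ≤toℕ-punchIn Fin.zero u = n≤1+n _
toℕ≤toℕ-punchIn (Fin.suc x) Fin.zero = z≤n
toℕ≤toℕ-punchIn (Fin.suc x) (Fin.suc u) = s≤s (toℕ≤toℕ-punchIn x u)

∣punchIn-punchIn∣ : ∀ {M} (x : Fin (suc M)) (u v : Fin M) →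
  ∣ toℕ u - toℕ v ∣ ≤ ∣ toℕ (punchIn x u) - toℕ (punchIn x v) ∣
∣punchIn-punchIn∣ Fin.zero u v = ≤-refl
∣punchIn-punchIn∣ (Fin.suc x) Fin.zero Fin.zero = ≤-refl
∣punchIn-punchIn∣ (Fin.suc x) Fin.zero (Fin.suc v) = s≤s (toℕ≤toℕ-punchIn x v)
∣punchIn-punchIn∣ (Fin.suc x) (Fin.suc u) Fin.zero = s≤s (toℕ≤toℕ-punchIn x u)
∣punchIn-punchIn∣ (Fin.suc x) (Fin.suc u) (Fin.suc v) = ∣punchIn-punchIn∣ x u v

∣x-punchIn∣ : ∀ {M} (x : Fin (suc M)) (u : Fin M) → ∣ toℕ x - toℕ u ∣ ≤ ∣ toℕ x - toℕ (punchIn x u) ∣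
∣x-punchIn∣ Fin.zero u = n≤1+n _
∣x-punchIn∣ (Fin.suc x) Fin.zero = ≤-refl
∣x-punchIn∣ (Fin.suc x) (Fin.suc u) = ∣x-punchIn∣ x u

closeAt : ∀ {M} → ℕ → Fin M → Fin M → Perm M → ℕ
closeAt W a b σ = close W (toℕ (lookup σ a)) (toℕ (lookup σ b))

closeAt-prepend : ∀ W {M} (x : Fin (suc M)) (τ : Perm M) a b →
  closeAt W (Fin.suc a) (Fin.suc b) (prepend x τ) ≤ closeAt W a b τ
closeAt-prepend W x τ a b =
  subst₂ (λ y z → close W (toℕ y) (toℕ z) ≤ closeAt W a b τ)
    (sym (lookup-map a (punchIn x) τ)) (sym (lookup-map b (punchIn x) τ))
    (𝟙-mono (≤-<-trans (∣punchIn-punchIn∣ x (lookup τ a) (lookup τ b))) (_ <? W) (_ <? W))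

closeAt-prepend-zero : ∀ W {M} (x : Fin (suc M)) (τ : Perm M) b →
  closeAt W Fin.zero (Fin.suc b) (prepend x τ) ≤ close W (toℕ x) (toℕ (lookup τ b))
closeAt-prepend-zero W x τ b =
  subst (λ y → close W (toℕ x) (toℕ y) ≤ close W (toℕ x) (toℕ (lookup τ b)))
    (sym (lookup-map b (punchIn x) τ))
    (𝟙-mono (≤-<-trans (∣x-punchIn∣ x (lookup τ b))) (_ <? W) (_ <? W))

∑-close : ∀ W {K} c → ∑[ u < K ] close W c (toℕ u) ≤ 2 * W
∑-close W {K} c = ∑-𝟙-window {K} (λ u → ∣ c - u ∣ <? W) (c ∸ W) (2 * W) λ {u} d<W →
  m≤n+o⇒m∸n≤o c W (begin
    c                  ≤⟨ m≤n+∣m-n∣ c u ⟩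
    u + ∣ c - u ∣      ≤⟨ +-monoʳ-≤ u (<⇒≤ d<W) ⟩
    u + W              ≡⟨ +-comm u W ⟩
    W + u              ∎) ,
  (begin-strict
    u                  ≤⟨ m≤n+∣m-n∣ u c ⟩
    c + ∣ u - c ∣      ≡⟨ cong (c +_) (∣-∣-comm u c) ⟩
    c + ∣ c - u ∣      <⟨ +-monoʳ-< c d<W ⟩
    c + W              ≤⟨ +-monoˡ-≤ W (m≤n+m∸n c W) ⟩
    W + (c ∸ W) + W    ≡⟨ solve 2 (λ w d → w :+ d :+ w := d :+ con 2 :* w) refl W (c ∸ W) ⟩
    c ∸ W + 2 * W      ∎)
  where
  open ≤-Reasoning
  open +-*-Solver

-- The weight is M ∸ 1 when a is the first position and drops by one for every
-- position peeled off before it.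
∑-allPerms-close : ∀ W M (a b : Fin M) → toℕ a < toℕ b →
  (M ∸ suc (toℕ a)) * ∑[ σ ∈ allPerms M ] closeAt W a b σ ≤ M ! * (2 * W)
∑-allPerms-close W (suc (suc M)) Fin.zero (Fin.suc b) _ = begin
  suc M * ∑[ σ ∈ allPerms (suc (suc M)) ] closeAt W Fin.zero (Fin.suc b) σ
    ≡⟨ cong (suc M *_) (sumOver-allPerms (suc M) _) ⟩
  suc M * ∑[ x < suc (suc M) ] ∑[ τ ∈ allPerms (suc M) ] closeAt W Fin.zero (Fin.suc b) (prepend x τ)
    ≤⟨ *-monoʳ-≤ (suc M) (∑-mono-≤ {suc (suc M)} λ x →
         sumOver-mono-≤ (allPerms (suc M)) λ τ → closeAt-prepend-zero W x τ b) ⟩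
  suc M * ∑[ x < suc (suc M) ] ∑[ τ ∈ allPerms (suc M) ] close W (toℕ x) (toℕ (lookup τ b))
    ≡⟨ cong (suc M *_) (∑-cong {suc (suc M)} λ x → ∑-allPerms-lookup M b (close W (toℕ x) ∘ toℕ)) ⟩
  suc M * ∑[ x < suc (suc M) ] (M ! * ∑[ u < suc M ] close W (toℕ x) (toℕ u))
    ≤⟨ *-monoʳ-≤ (suc M) (∑-mono-≤ {suc (suc M)} λ x → *-monoʳ-≤ (M !) (∑-close W {suc M} (toℕ x))) ⟩
  suc M * ∑[ x < suc (suc M) ] (M ! * (2 * W))
    ≡⟨ cong (suc M *_) (∑-const {suc (suc M)} (M ! * (2 * W))) ⟩
  suc M * (suc (suc M) * (M ! * (2 * W)))
    ≡⟨ solve 4 (λ m m' f w → m :* (m' :* (f :* w)) := m' :* (m :* f) :* w)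
               refl (suc M) (suc (suc M)) (M !) (2 * W) ⟩
  suc (suc M) ! * (2 * W) ∎
  where
  open ≤-Reasoning
  open +-*-Solver
∑-allPerms-close W (suc M) (Fin.suc a) (Fin.suc b) (s≤s a<b) = begin
  k * ∑[ σ ∈ allPerms (suc M) ] closeAt W (Fin.suc a) (Fin.suc b) σ
    ≡⟨ cong (k *_) (sumOver-allPerms M _) ⟩
  k * ∑[ x < suc M ] ∑[ τ ∈ allPerms M ] closeAt W (Fin.suc a) (Fin.suc b) (prepend x τ)
    ≤⟨ *-monoʳ-≤ k (∑-mono-≤ {suc M} λ x → sumOver-mono-≤ (allPerms M) λ τ → closeAt-prepend W x τ a b) ⟩
  k * ∑[ x < suc M ] ∑[ τ ∈ allPerms M ] closeAt W a b τ
    ≡⟨ cong (k *_) (∑-const {suc M} _) ⟩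
  k * (suc M * ∑[ τ ∈ allPerms M ] closeAt W a b τ)
    ≡⟨ solve 3 (λ k m s → k :* (m :* s) := m :* (k :* s)) refl k (suc M) _ ⟩
  suc M * (k * ∑[ τ ∈ allPerms M ] closeAt W a b τ)
    ≤⟨ *-monoʳ-≤ (suc M) (∑-allPerms-close W M a b a<b) ⟩
  suc M * (M ! * (2 * W))
    ≡⟨ *-assoc (suc M) (M !) (2 * W) ⟨
  suc M ! * (2 * W) ∎
  where
  open ≤-Reasoning
  open +-*-Solver
  k = M ∸ suc (toℕ a)

shortIntervals : ∀ n → ℕ → Outcome n → ℕ
shortIntervals n W σ = ∑[ j < n ] close W (X σ j) (Y σ j)

∑-allPerms-shortIntervals : ∀ n .{{_ : NonZero n}} W →
  ∑[ σ ∈ allPerms (n + n) ] shortIntervals n W σ ≤ (n + n) ! * (2 * W)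
∑-allPerms-shortIntervals n W = *-cancelˡ-≤ n (begin
  n * ∑[ σ ∈ allPerms (n + n) ] shortIntervals n W σ
    ≡⟨ cong (n *_) (sumOver-∑ {K = n} (λ σ j → close W (X σ j) (Y σ j)) (allPerms (n + n))) ⟩
  n * ∑[ j < n ] closeCount j                      ≡⟨ *-distribˡ-sum {n} n closeCount ⟩
  ∑[ j < n ] (n * closeCount j)                    ≤⟨ ∑-mono-≤ {n} (λ j → *-monoˡ-≤ (closeCount j) (n≤gap j)) ⟩
  ∑[ j < n ] ((n + n ∸ suc (toℕ (j ↑ˡ n))) * closeCount j)
    ≤⟨ ∑-mono-≤ {n} (λ j → ∑-allPerms-close W (n + n) (j ↑ˡ n) (n ↑ʳ j) (left<right j)) ⟩
  ∑[ j < n ] ((n + n) ! * (2 * W))                 ≡⟨ ∑-const {n} _ ⟩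
  n * ((n + n) ! * (2 * W))                        ∎)
  where
  open ≤-Reasoning
  closeCount : Fin n → ℕ
  closeCount j = ∑[ σ ∈ allPerms (n + n) ] close W (X σ j) (Y σ j)
  left<right : ∀ j → toℕ (j ↑ˡ n) < toℕ (n ↑ʳ j)
  left<right j = subst₂ _<_ (sym (toℕ-↑ˡ j n)) (sym (toℕ-↑ʳ n j)) (≤-trans (toℕ<n j) (m≤m+n n (toℕ j)))
  n≤gap : ∀ j → n ≤ n + n ∸ suc (toℕ (j ↑ˡ n))
  n≤gap j = subst (λ k → n ≤ n + n ∸ suc k) (sym (toℕ-↑ˡ j n))
    (≤-trans (≤-reflexive (sym (m+n∸n≡m n n))) (∸-monoʳ-≤ (n + n) (toℕ<n j)))

-- Decision trees

module _ {n} {a b : Fin n} {l r : DTree n} {ρ : Fin n → Fin n} where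

  node-left : T (toℕ (ρ a) <ᵇ toℕ (ρ b)) →
              run (node a b l r) ρ ≡ run l ρ × cost (node a b l r) ρ ≡ suc (cost l ρ)
  node-left _ with toℕ (ρ a) <ᵇ toℕ (ρ b)
  ... | true = refl , refl

  node-right : ¬ T (toℕ (ρ a) <ᵇ toℕ (ρ b)) →
               run (node a b l r) ρ ≡ run r ρ × cost (node a b l r) ρ ≡ suc (cost r ρ)
  node-right ¬t with toℕ (ρ a) <ᵇ toℕ (ρ b)
  ... | true = ⊥-elim (¬t tt)
  ... | false = refl , refl

decisionTree-capacity : ∀ {n} (t : DTree n) d (ρs : List (Fin n → Fin n)) →
  AllPairs (λ ρ ρ' → ¬ ρ ≗ ρ') ρs →
  All (λ ρ → run t ρ ≗ ρ) ρs → All (λ ρ → cost t ρ ≤ d) ρs → length ρs ≤ 2 ^ d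
decisionTree-capacity (leaf o) d [] _ _ _ = z≤n
decisionTree-capacity (leaf o) d (ρ ∷ []) _ _ _ = m^n>0 2 d
decisionTree-capacity (leaf o) d (ρ ∷ ρ' ∷ _) ((ρ≉ρ' ∷ _) ∷ _) (o≗ρ ∷ o≗ρ' ∷ _) _ =
  ⊥-elim (ρ≉ρ' λ i → trans (sym (o≗ρ i)) (o≗ρ' i))
decisionTree-capacity (node a b l r) zero [] _ _ _ = z≤n
decisionTree-capacity (node a b l r) zero (ρ ∷ _) _ _ (() ∷ _)
decisionTree-capacity {n} (node a b l r) (suc d) ρs distinct sorted fast = begin
  length ρs                                                      ≡⟨ length-filter-∁ goesLeft? ρs ⟩
  length (filter goesLeft? ρs) + length (filter (¬? ∘ goesLeft?) ρs)
    ≤⟨ +-mono-≤ (branch goesLeft? l node-left) (branch (¬? ∘ goesLeft?) r node-right) ⟩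
  2 ^ d + 2 ^ d                                                  ≡⟨ cong (2 ^ d +_) (+-identityʳ (2 ^ d)) ⟨
  2 ^ suc d                                                      ∎
  where
  open ≤-Reasoning
  goesLeft? : ∀ ρ → Dec (T (toℕ (ρ a) <ᵇ toℕ (ρ b)))
  goesLeft? ρ = T? (toℕ (ρ a) <ᵇ toℕ (ρ b))
  branch : ∀ {Q : (Fin n → Fin n) → Set} (Q? : ∀ ρ → Dec (Q ρ)) t →
           (∀ {ρ} → Q ρ → run (node a b l r) ρ ≡ run t ρ × cost (node a b l r) ρ ≡ suc (cost t ρ)) →
           length (filter Q? ρs) ≤ 2 ^ d
  branch Q? t step = decisionTree-capacity t d _ (AllPairs.filter⁺ Q? distinct)
    (All.zipWith (λ (s , q) i → trans (cong (λ f → f i) (sym (proj₁ (step q)))) (s i)) (All.filter⁺ Q? sorted , all-filter Q? ρs))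
    (All.zipWith (λ (c , q) → s≤s⁻¹ (subst (_≤ suc d) (proj₂ (step q)) c)) (All.filter⁺ Q? fast , all-filter Q? ρs))

decisionTree-worstCase : ∀ {n} (t : DTree n) (ρs : List (Fin n → Fin n)) → ρs ≢ [] →
  AllPairs (λ ρ ρ' → ¬ ρ ≗ ρ') ρs → All (λ ρ → run t ρ ≗ ρ) ρs →
  ∃[ ρ ] ρ ∈ ρs × length ρs ≤ 2 ^ cost t ρ
decisionTree-worstCase t [] ρs≢[] _ _ = ⊥-elim (ρs≢[] refl)
decisionTree-worstCase t (ρ₀ ∷ ρs) _ distinct sorted = worst , worst∈ ,
  decisionTree-capacity t (cost t worst) (ρ₀ ∷ ρs) distinct sorted
    (f[⊥]≤f[argmax] {f = cost t} ρ₀ ρs ∷ f[xs]≤f[argmax] {f = cost t} ρ₀ ρs)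
  where
  worst = argmax (cost t) ρ₀ ρs
  worst∈ : worst ∈ ρ₀ ∷ ρs
  worst∈ with argmax-sel (cost t) ρ₀ ρs
  ... | inj₁ worst≡ρ₀ = here worst≡ρ₀
  ... | inj₂ worst∈ρs = there worst∈ρs

PermTuple : (K : ℕ) → (Fin K → ℕ) → Set
PermTuple zero g = ⊤
PermTuple (suc K) g = Perm (g Fin.zero) × PermTuple K (g ∘ Fin.suc)

component : ∀ {K g} → PermTuple K g → (w : Fin K) → Perm (g w)
component (π , _) Fin.zero = π
component (_ , t) (Fin.suc w) = component t w

allPermTuples : ∀ K g → List (PermTuple K g)
allPermTuples zero g = tt ∷ []
allPermTuples (suc K) g = cartesianProduct (allPerms (g Fin.zero)) (allPermTuples K (g ∘ Fin.suc))

allPermTuples⁺ : ∀ K g → Unique (allPermTuples K g)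
allPermTuples⁺ zero g = [] ∷ []
allPermTuples⁺ (suc K) g = Unique.cartesianProduct⁺ (allPerms⁺ (g Fin.zero)) (allPermTuples⁺ K (g ∘ Fin.suc))

component-∈ : ∀ {K g} {t : PermTuple K g} → t ∈ allPermTuples K g → ∀ w → component t w ∈ allPerms (g w)
component-∈ {suc K} {g} t∈ Fin.zero = proj₁ (∈-cartesianProduct⁻ (allPerms (g Fin.zero)) _ t∈)
component-∈ {suc K} {g} t∈ (Fin.suc w) = component-∈ (proj₂ (∈-cartesianProduct⁻ (allPerms (g Fin.zero)) _ t∈)) w

component-ext : ∀ {K g} {t t' : PermTuple K g} → (∀ w → component t w ≡ component t' w) → t ≡ t'
component-ext {zero} _ = refl
component-ext {suc K} eq = cong₂ _,_ (eq Fin.zero) (component-ext (eq ∘ Fin.suc))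

^∸≤! : ∀ m c → c ^ (m ∸ c) ≤ m !
^∸≤! zero c = ≤-reflexive (cong (c ^_) (0∸n≡0 c))
^∸≤! (suc m) c with c ≤? m
... | yes c≤m = begin
  c ^ (suc m ∸ c)    ≡⟨ cong (c ^_) (+-∸-assoc 1 c≤m) ⟩
  c * c ^ (m ∸ c)    ≤⟨ *-mono-≤ (m≤n⇒m≤1+n c≤m) (^∸≤! m c) ⟩
  suc m * m !        ∎
  where open ≤-Reasoning
... | no c≰m = ≤-trans (≤-reflexive (cong (c ^_) (m≤n⇒m∸n≡0 (≰⇒> c≰m)))) (1≤n! (suc m))

length-allPermTuples : ∀ K g c → c ^ ∑[ w < K ] (g w ∸ c) ≤ length (allPermTuples K g)
length-allPermTuples zero g c = ≤-refl
length-allPermTuples (suc K) g c = begin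
  c ^ (g Fin.zero ∸ c + ∑[ w < K ] (g (Fin.suc w) ∸ c))       ≡⟨ ^-distribˡ-+-* c (g Fin.zero ∸ c) _ ⟩
  c ^ (g Fin.zero ∸ c) * c ^ ∑[ w < K ] (g (Fin.suc w) ∸ c)
    ≤⟨ *-mono-≤ (^∸≤! (g Fin.zero) c) (length-allPermTuples K (g ∘ Fin.suc) c) ⟩
  g Fin.zero ! * length (allPermTuples K (g ∘ Fin.suc))
    ≡⟨ cong (_* length (allPermTuples K (g ∘ Fin.suc))) (length-allPerms (g Fin.zero)) ⟨
  length (allPerms (g Fin.zero)) * length (allPermTuples K (g ∘ Fin.suc))
    ≡⟨ length-cartesianProductWith _,_ (allPerms (g Fin.zero)) _ ⟨
  length (allPermTuples (suc K) g)                            ∎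
  where open ≤-Reasoning

module _ {n} {R : Fin n → Set} (R? : ∀ i → Dec (R i)) where

  count : ℕ
  count = ∑[ i < n ] 𝟙 (R? i)

  rankBy : (Fin n → ℕ) → Fin n → ℕ
  rankBy key j = ∑[ i < n ] 𝟙 (R? i ×-dec key i <? key j)

  rankBy<count : ∀ key {j} → R j → rankBy key j < count
  rankBy<count key {j} Rj = ∑-mono-< {n} (λ i → 𝟙-mono proj₁ (R? i ×-dec _) (R? i)) j
    (subst₂ _<_ (sym (𝟙-no (λ (_ , kj<kj) → <-irrefl refl kj<kj) (R? j ×-dec _))) (sym (𝟙-yes Rj (R? j)))
      (s≤s z≤n))

  rankBy-mono : ∀ key {i j} → R i → key i < key j → rankBy key i < rankBy key j
  rankBy-mono key {i} {j} Ri ki<kj =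
    ∑-mono-< {n} (λ k → 𝟙-mono (λ (Rk , kk<ki) → Rk , <-trans kk<ki ki<kj) (R? k ×-dec _) (R? k ×-dec _)) i
      (subst₂ _<_ (sym (𝟙-no (λ (_ , ki<ki) → <-irrefl refl ki<ki) (R? i ×-dec _)))
                  (sym (𝟙-yes (Ri , ki<kj) (R? i ×-dec _))) (s≤s z≤n))

  count≤n : count ≤ n
  count≤n = ≤-trans (∑-mono-≤ {n} λ i → 𝟙≤1 (R? i)) (≤-reflexive (trans (∑-const {n} 1) (*-identityʳ n)))

  rankBy-reflects : ∀ key {i j} → R j → rankBy key i < rankBy key j → key i < key j
  rankBy-reflects key {i} {j} Rj ri<rj with <-cmp (key i) (key j)
  ... | tri< ki<kj _ _ = ki<kj
  ... | tri≈ _ ki≡kj _ = ⊥-elim (<-irrefl (cong (λ k → ∑[ l < n ] 𝟙 (R? l ×-dec key l <? k)) ki≡kj) ri<rj)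
  ... | tri> _ _ kj<ki = ⊥-elim (<-asym ri<rj (rankBy-mono key Rj kj<ki))

  rankBy-injective : ∀ key {i j} → R i → R j → rankBy key i ≡ rankBy key j → key i ≡ key j
  rankBy-injective key {i} {j} Ri Rj ri≡rj with <-cmp (key i) (key j)
  ... | tri< ki<kj _ _ = ⊥-elim (<-irrefl ri≡rj (rankBy-mono key Ri ki<kj))
  ... | tri≈ _ ki≡kj _ = ki≡kj
  ... | tri> _ _ kj<ki = ⊥-elim (<-irrefl (sym ri≡rj) (rankBy-mono key Rj kj<ki))

module _ {n} {R : Fin (suc n) → Set} (R? : ∀ i → Dec (R i)) where

  rankBy-toℕ-zero : rankBy R? toℕ Fin.zero ≡ 0
  rankBy-toℕ-zero = ∑-zero {suc n} λ i → 𝟙-no (λ ()) (R? i ×-dec toℕ i <? 0)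

  rankBy-toℕ-suc : ∀ j → rankBy R? toℕ (Fin.suc j) ≡ 𝟙 (R? Fin.zero) + rankBy (R? ∘ Fin.suc) toℕ j
  rankBy-toℕ-suc j = cong₂ _+_ (𝟙-cong proj₁ (_, z<s) _ (R? Fin.zero))
    (∑-cong {n} λ i → 𝟙-cong (Product.map₂ s<s⁻¹) (Product.map₂ s<s) _ _)

rankBy-toℕ-surjective : ∀ {n} {R : Fin n → Set} (R? : ∀ i → Dec (R i)) a → a < count R? →
  ∃[ j ] R j × rankBy R? toℕ j ≡ a
rankBy-toℕ-surjective {suc n} {R} R? = cases (R? Fin.zero)
  where
  cases : Dec (R Fin.zero) → ∀ a → a < count R? → ∃[ j ] R j × rankBy R? toℕ j ≡ a
  cases (yes R0) zero _ = Fin.zero , R0 , rankBy-toℕ-zero R?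
  cases (yes R0) (suc a) a<count
    with j , Rj , rank≡a ← rankBy-toℕ-surjective (R? ∘ Fin.suc) a
           (s<s⁻¹ (subst (λ c → suc a < c + count (R? ∘ Fin.suc)) (𝟙-yes R0 (R? Fin.zero)) a<count))
    = Fin.suc j , Rj , trans (rankBy-toℕ-suc R? j) (cong₂ _+_ (𝟙-yes R0 (R? Fin.zero)) rank≡a)
  cases (no ¬R0) a a<count
    with j , Rj , rank≡a ← rankBy-toℕ-surjective (R? ∘ Fin.suc) a
           (subst (λ c → a < c + count (R? ∘ Fin.suc)) (𝟙-no ¬R0 (R? Fin.zero)) a<count)
    = Fin.suc j , Rj , trans (rankBy-toℕ-suc R? j) (cong₂ _+_ (𝟙-no ¬R0 (R? Fin.zero)) rank≡a)

m<[1+m/n]*n : ∀ m n .{{_ : NonZero n}} → m < suc (m / n) * n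
m<[1+m/n]*n m n = begin-strict
  m                   ≡⟨ m≡m%n+[m/n]*n m n ⟩
  m % n + m / n * n   <⟨ +-monoˡ-< (m / n * n) (m%n<n m n) ⟩
  n + m / n * n       ∎
  where open ≤-Reasoning

∣-∣≡⊔∸⊓ : ∀ x y → ∣ x - y ∣ ≡ x ⊔ y ∸ x ⊓ y
∣-∣≡⊔∸⊓ x y with ≤-total x y
... | inj₁ x≤y = trans (m≤n⇒∣m-n∣≡n∸m x≤y) (sym (cong₂ _∸_ (m≤n⇒m⊔n≡n x≤y) (m≤n⇒m⊓n≡m x≤y)))
... | inj₂ y≤x = trans (m≤n⇒∣n-m∣≡n∸m y≤x) (sym (cong₂ _∸_ (m≥n⇒m⊔n≡m y≤x) (m≥n⇒m⊓n≡n y≤x)))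

lex-< : ∀ B {a a' s s'} → a < a' → s < B → a * B + s < a' * B + s'
lex-< B {a} {a'} {s} {s'} a<a' s<B = begin-strict
  a * B + s     <⟨ +-monoʳ-< (a * B) s<B ⟩
  a * B + B     ≡⟨ +-comm (a * B) B ⟩
  suc a * B     ≤⟨ *-monoˡ-≤ B a<a' ⟩
  a' * B        ≤⟨ m≤m+n (a' * B) s' ⟩
  a' * B + s'   ∎
  where open ≤-Reasoning

lex-injective : ∀ B {a a' s s'} → s < B → s' < B → a * B + s ≡ a' * B + s' → a ≡ a' × s ≡ s'
lex-injective B {a} {a'} s<B s'<B eq with <-cmp a a'
... | tri< a<a' _ _ = ⊥-elim (<-irrefl eq (lex-< B a<a' s<B))
... | tri≈ _ refl _ = refl , +-cancelˡ-≡ (a * B) _ _ eq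
... | tri> _ _ a'<a = ⊥-elim (<-irrefl (sym eq) (lex-< B a'<a s'<B))

∑≤*+∑∸ : ∀ {K} (g : Fin K → ℕ) c → ∑[ w < K ] g w ≤ K * c + ∑[ w < K ] (g w ∸ c)
∑≤*+∑∸ {K} g c = begin
  ∑[ w < K ] g w                           ≤⟨ ∑-mono-≤ {K} (λ w → m≤n+m∸n (g w) c) ⟩
  ∑[ w < K ] (c + (g w ∸ c))               ≡⟨ ∑-distrib-+ (λ _ → c) (λ w → g w ∸ c) ⟩
  ∑[ w < K ] c + ∑[ w < K ] (g w ∸ c)      ≡⟨ cong (_+ ∑[ w < K ] (g w ∸ c)) (∑-const {K} c) ⟩
  K * c + ∑[ w < K ] (g w ∸ c)             ∎
  where open ≤-Reasoning

3n≤4E : ∀ {n c s a E} → n ≤ c + s → c ≤ a + E → 8 * s ≤ n → 8 * a ≤ n → 3 * n ≤ 4 * E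
3n≤4E {n} {c} {s} {a} {E} n≤c+s c≤a+E 8s≤n 8a≤n = *-cancelˡ-≤ 2 (+-cancelʳ-≤ (n + n) _ _ (begin
  2 * (3 * n) + (n + n)       ≡⟨ solve 1 (λ n → con 2 :* (con 3 :* n) :+ (n :+ n) := con 8 :* n) refl n ⟩
  8 * n                       ≤⟨ *-monoʳ-≤ 8 (≤-trans n≤c+s (+-monoˡ-≤ s c≤a+E)) ⟩
  8 * (a + E + s)
    ≡⟨ solve 3 (λ a E s → con 8 :* (a :+ E :+ s) := con 8 :* E :+ (con 8 :* a :+ con 8 :* s)) refl a E s ⟩
  8 * E + (8 * a + 8 * s)     ≤⟨ +-monoʳ-≤ (8 * E) (+-mono-≤ 8a≤n 8s≤n) ⟩
  8 * E + (n + n)             ≡⟨ cong (_+ (n + n)) (solve 1 (λ E → con 8 :* E := con 2 :* (con 4 :* E)) refl E) ⟩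
  2 * (4 * E) + (n + n)       ∎))
  where
  open ≤-Reasoning
  open +-*-Solver

n^2n≤len^4 : ∀ {n t E len} .{{_ : NonZero t}} → n * n ≤ t ^ 3 → 3 * n ≤ 4 * E → t ^ E ≤ len → n ^ (2 * n) ≤ len ^ 4
n^2n≤len^4 {n} {t} {E} {len} n²≤t³ 3n≤4E tᴱ≤len = begin
  n ^ (2 * n)         ≡⟨ ^-*-assoc n 2 n ⟨
  (n ^ 2) ^ n         ≡⟨ cong (λ x → x ^ n) (cong (n *_) (*-identityʳ n)) ⟩
  (n * n) ^ n         ≤⟨ ^-monoˡ-≤ n n²≤t³ ⟩
  (t ^ 3) ^ n         ≡⟨ ^-*-assoc t 3 n ⟩
  t ^ (3 * n)         ≤⟨ ^-monoʳ-≤ t 3n≤4E ⟩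
  t ^ (4 * E)         ≡⟨ cong (t ^_) (*-comm 4 E) ⟩
  t ^ (E * 4)         ≡⟨ ^-*-assoc t E 4 ⟨
  (t ^ E) ^ 4         ≤⟨ ^-monoˡ-≤ 4 tᴱ≤len ⟩
  len ^ 4             ∎
  where open ≤-Reasoning

fastSorting-impossible : ∀ {n m len d} .{{_ : NonZero n}} →
  n ^ (2 * n) ≤ len ^ 4 → len ≤ 2 ^ d → 2 ^ (2 * d * suc m) < n ^ (m * n) → ⊥
fastSorting-impossible {n} {m} {len} {d} n^2n≤len^4 len≤2^d fast = <-irrefl refl (begin-strict
  n ^ (2 * n * suc m)           ≡⟨ ^-*-assoc n (2 * n) (suc m) ⟨
  (n ^ (2 * n)) ^ suc m         ≤⟨ ^-monoˡ-≤ (suc m) (≤-trans n^2n≤len^4 (^-monoˡ-≤ 4 len≤2^d)) ⟩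
  ((2 ^ d) ^ 4) ^ suc m         ≡⟨ trans (^-*-assoc (2 ^ d) 4 (suc m)) (^-*-assoc 2 d (4 * suc m)) ⟩
  2 ^ (d * (4 * suc m))
    ≡⟨ cong (2 ^_) (solve 2 (λ d m → d :* (con 4 :* m) := con 2 :* d :* m :* con 2) refl d (suc m)) ⟩
  2 ^ (2 * d * suc m * 2)       ≡⟨ ^-*-assoc 2 (2 * d * suc m) 2 ⟨
  (2 ^ (2 * d * suc m)) ^ 2     <⟨ ^-monoˡ-< 2 fast ⟩
  (n ^ (m * n)) ^ 2             ≡⟨ ^-*-assoc n (m * n) 2 ⟩
  n ^ (m * n * 2)
    ≤⟨ ^-monoʳ-≤ n (≤-reflexive (solve 2 (λ m n → m :* n :* con 2 := con 2 :* n :* m) refl m n)) ⟩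
  n ^ (2 * n * m)               ≤⟨ ^-monoʳ-≤ n (*-monoʳ-≤ (2 * n) (n≤1+n m)) ⟩
  n ^ (2 * n * suc m)           ∎)
  where
  open ≤-Reasoning
  open +-*-Solver

-- Windows

module Windows {n} (σ : Outcome n) (W : ℕ) .{{_ : NonZero W}} (Nw : ℕ) (span : n + n ≤ Nw * W) where

  lo hi : Fin n → ℕ
  lo j = X σ j ⊓ Y σ j
  hi j = X σ j ⊔ Y σ j

  lo≤hi : ∀ j → lo j ≤ hi j
  lo≤hi j = m⊓n≤m⊔n (X σ j) (Y σ j)

  window : Fin n → Fin Nw
  window j = fromℕ< (m<n*o⇒m/o<n (<-≤-trans lo<n+n span))
    where
    lo<n+n : lo j < n + n
    lo<n+n = ≤-<-trans (m⊓n≤m (X σ j) (Y σ j)) (toℕ<n (lookup σ (j ↑ˡ n)))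

  toℕ-window : ∀ j → toℕ (window j) ≡ lo j / W
  toℕ-window j = toℕ-fromℕ< _

  -- Some multiple of W, namely suc (lo j / W) * W, lies in (lo j, hi j].
  Covered : Fin n → Set
  Covered j = lo j / W < hi j / W

  covered? : ∀ j → Dec (Covered j)
  covered? j = lo j / W <? hi j / W

  anchor : Fin n → ℕ
  anchor j with covered? j
  ... | yes _ = suc (lo j / W) * W
  ... | no _ = lo j

  anchor-covered : ∀ {j} → Covered j → anchor j ≡ suc (lo j / W) * W
  anchor-covered {j} c with covered? j
  ... | yes _ = refl
  ... | no ¬c = ⊥-elim (¬c c)

  lo≤anchor : ∀ j → lo j ≤ anchor j
  lo≤anchor j with covered? j
  ... | yes _ = <⇒≤ (m<[1+m/n]*n (lo j) W)
  ... | no _ = ≤-refl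

  anchor≤hi : ∀ j → anchor j ≤ hi j
  anchor≤hi j with covered? j
  ... | yes c = ≤-trans (*-monoˡ-≤ W c) (m/n*n≤m (hi j) W)
  ... | no _ = lo≤hi j

  anchor-mono : ∀ {i j} → Prec σ i j → anchor i < anchor j
  anchor-mono {i} {j} i≺j = ≤-<-trans (anchor≤hi i) (<-≤-trans i≺j (lo≤anchor j))

  uncovered⇒short : ∀ {j} → ¬ Covered j → ∣ X σ j - Y σ j ∣ < W
  uncovered⇒short {j} ¬c = subst (_< W) (sym (∣-∣≡⊔∸⊓ (X σ j) (Y σ j))) (begin-strict
    hi j ∸ lo j       <⟨ ∸-monoˡ-< hi<W+lo (lo≤hi j) ⟩
    W + lo j ∸ lo j   ≡⟨ m+n∸n≡m W (lo j) ⟩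
    W                 ∎)
    where
    open ≤-Reasoning
    hi<W+lo : hi j < W + lo j
    hi<W+lo = begin-strict
      hi j                 <⟨ m<[1+m/n]*n (hi j) W ⟩
      suc (hi j / W) * W   ≤⟨ *-monoˡ-≤ W (s≤s (≮⇒≥ ¬c)) ⟩
      suc (lo j / W) * W   ≤⟨ +-monoʳ-≤ W (m/n*n≤m (lo j) W) ⟩
      W + lo j             ∎

  n≤covered+short : n ≤ count covered? + shortIntervals n W σ
  n≤covered+short = begin
    n                                                          ≡⟨ *-identityʳ n ⟨
    n * 1                                                      ≡⟨ ∑-const {n} 1 ⟨
    ∑[ j < n ] 1                                               ≤⟨ ∑-mono-≤ {n} one≤ ⟩
    ∑[ j < n ] (𝟙 (covered? j) + close W (X σ j) (Y σ j))      ≡⟨ ∑-distrib-+ (𝟙 ∘ covered?) _ ⟩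
    count covered? + shortIntervals n W σ                      ∎
    where
    open ≤-Reasoning
    one≤ : ∀ j → 1 ≤ 𝟙 (covered? j) + close W (X σ j) (Y σ j)
    one≤ j with covered? j
    ... | yes _ = s≤s z≤n
    ... | no ¬c = ≤-reflexive (sym (𝟙-yes (uncovered⇒short ¬c) (∣ X σ j - Y σ j ∣ <? W)))

  InWindow : Fin Nw → Fin n → Set
  InWindow w j = Covered j × window j ≡ w

  inWindow? : ∀ w j → Dec (InWindow w j)
  inWindow? w j = covered? j ×-dec window j Fin.≟ w

  size : Fin Nw → ℕ
  size w = count (inWindow? w)

  ∑-size : ∑[ w < Nw ] size w ≡ count covered?
  ∑-size = trans (∑-comm {Nw} {n} λ w j → 𝟙 (inWindow? w j)) (∑-cong {n} λ j → ∑-𝟙-×-≟ (covered? j) (window j))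

  anchor-inWindow : ∀ {w j} → InWindow w j → anchor j ≡ suc (toℕ w) * W
  anchor-inWindow {j = j} (c , refl) = trans (anchor-covered c) (cong (λ k → suc k * W) (sym (toℕ-window j)))

  indexIn : ∀ {w j} → InWindow w j → Fin (size w)
  indexIn {w} j∈w = fromℕ< (rankBy<count (inWindow? w) toℕ j∈w)

  indexIn-injective : ∀ {w i j} (i∈w : InWindow w i) (j∈w : InWindow w j) → indexIn i∈w ≡ indexIn j∈w → i ≡ j
  indexIn-injective {w} i∈w j∈w eq = toℕ-injective (rankBy-injective (inWindow? w) toℕ i∈w j∈w
    (trans (sym (toℕ-fromℕ< _)) (trans (cong toℕ eq) (toℕ-fromℕ< _))))

  indexIn-surjective : ∀ {w} (a : Fin (size w)) → ∃[ j ] Σ (InWindow w j) λ j∈w → indexIn j∈w ≡ a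
  indexIn-surjective {w} a with rankBy-toℕ-surjective (inWindow? w) (toℕ a) (toℕ<n a)
  ... | j , j∈w , rank≡a = j , j∈w , toℕ-injective (trans (toℕ-fromℕ< _) rank≡a)

  Tuple : Set
  Tuple = PermTuple Nw size

  -- Covered intervals of a window are ordered by that window's permutation, uncovered
  -- ones by their index and after every covered one (their tie is at least n).
  tieBy : Tuple → ∀ j → Dec (Covered j) → ℕ
  tieBy t j (yes c) = toℕ (lookup (component t (window j)) (indexIn (c , refl)))
  tieBy t j (no _) = n + toℕ j

  tie : Tuple → Fin n → ℕ
  tie t j = tieBy t j (covered? j)

  tie-inWindow : ∀ t {w j} (j∈w : InWindow w j) {a} → indexIn j∈w ≡ a → tie t j ≡ toℕ (lookup (component t w) a)
  tie-inWindow t {j = j} (c , refl) refl = tieBy-covered (covered? j)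
    where
    tieBy-covered : ∀ c? → tieBy t j c? ≡ toℕ (lookup (component t (window j)) (indexIn (c , refl)))
    tieBy-covered (yes _) = refl
    tieBy-covered (no ¬c) = ⊥-elim (¬c c)

  tie-uncovered : ∀ t {j} → ¬ Covered j → tie t j ≡ n + toℕ j
  tie-uncovered t {j} ¬c = tieBy-uncovered (covered? j)
    where
    tieBy-uncovered : ∀ c? → tieBy t j c? ≡ n + toℕ j
    tieBy-uncovered (yes c) = ⊥-elim (¬c c)
    tieBy-uncovered (no _) = refl

  tie-covered<n : ∀ t {j} → Covered j → tie t j < n
  tie-covered<n t {j} c = subst (_< n) (sym (tie-inWindow t (c , refl) refl))
    (<-≤-trans (toℕ<n (lookup (component t (window j)) _)) (count≤n (inWindow? (window j))))

  tie<n+n : ∀ t j → tie t j < n + n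
  tie<n+n t j = cases (covered? j)
    where
    cases : Dec (Covered j) → tie t j < n + n
    cases (yes c) = <-≤-trans (tie-covered<n t c) (m≤m+n n n)
    cases (no ¬c) = subst (_< n + n) (sym (tie-uncovered t ¬c)) (+-monoʳ-< n (toℕ<n j))

  priority : Tuple → Fin n → ℕ
  priority t j = anchor j * (n + n) + tie t j

  priority-mono : ∀ t {i j} → Prec σ i j → priority t i < priority t j
  priority-mono t {i} i≺j = lex-< (n + n) (anchor-mono i≺j) (tie<n+n t i)

  priority-inWindow : ∀ t {w j} → InWindow w j → priority t j ≡ suc (toℕ w) * W * (n + n) + tie t j
  priority-inWindow t {j = j} j∈w = cong (λ a → a * (n + n) + tie t j) (anchor-inWindow j∈w)

  priority-injective : ∀ {t} → t ∈ allPermTuples Nw size → ∀ {i j} → priority t i ≡ priority t j → i ≡ j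
  priority-injective {t} t∈ {i} {j} eq = cases (covered? i) (covered? j)
    where
    anchor≡ = proj₁ (lex-injective (n + n) {anchor i} {anchor j} (tie<n+n t i) (tie<n+n t j) eq)
    tie≡ = proj₂ (lex-injective (n + n) {anchor i} {anchor j} (tie<n+n t i) (tie<n+n t j) eq)
    cases : Dec (Covered i) → Dec (Covered j) → i ≡ j
    cases (yes ci) (yes cj) = indexIn-injective i∈w j∈w
      (allPerms-injective (component-∈ t∈ (window i)) (toℕ-injective
        (trans (sym (tie-inWindow t i∈w refl)) (trans tie≡ (tie-inWindow t j∈w refl)))))
      where
      same-window : window j ≡ window i
      same-window = toℕ-injective (trans (toℕ-window j) (trans
        (sym (suc-injective (*-cancelʳ-≡ _ _ W (trans (sym (anchor-covered ci)) (trans anchor≡ (anchor-covered cj))))))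
        (sym (toℕ-window i))))
      i∈w : InWindow (window i) i
      i∈w = ci , refl
      j∈w : InWindow (window i) j
      j∈w = cj , same-window
    cases (yes ci) (no ¬cj) = ⊥-elim (<-irrefl refl (<-≤-trans (tie-covered<n t ci)
      (subst (n ≤_) (trans (sym (tie-uncovered t ¬cj)) (sym tie≡)) (m≤m+n n (toℕ j)))))
    cases (no ¬ci) (yes cj) = ⊥-elim (<-irrefl refl (<-≤-trans (tie-covered<n t cj)
      (subst (n ≤_) (trans (sym (tie-uncovered t ¬ci)) tie≡) (m≤m+n n (toℕ i)))))
    cases (no ¬ci) (no ¬cj) = toℕ-injective (+-cancelˡ-≡ n _ _
      (trans (sym (tie-uncovered t ¬ci)) (trans tie≡ (tie-uncovered t ¬cj))))

  everyone? : ∀ (j : Fin n) → Dec ⊤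
  everyone? _ = yes tt

  rank : Tuple → Fin n → ℕ
  rank t = rankBy everyone? (priority t)

  rank<n : ∀ t j → rank t j < n
  rank<n t j = <-≤-trans (rankBy<count everyone? (priority t) tt) (count≤n everyone?)

  extension : Tuple → Fin n → Fin n
  extension t j = fromℕ< (rank<n t j)

  toℕ-extension : ∀ t j → toℕ (extension t j) ≡ rank t j
  toℕ-extension t j = toℕ-fromℕ< (rank<n t j)

  extension-isLinExt : ∀ {t} → t ∈ allPermTuples Nw size → IsLinExt σ (extension t)
  extension-isLinExt {t} t∈ =
    (λ a b eq → priority-injective t∈ (rankBy-injective everyone? (priority t) tt tt
       (trans (sym (toℕ-extension t a)) (trans (cong toℕ eq) (toℕ-extension t b))))) ,
    (λ i j i≺j → subst₂ _<_ (sym (toℕ-extension t i)) (sym (toℕ-extension t j))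
       (rankBy-mono everyone? (priority t) tt (priority-mono t i≺j)))

  rank-extension : ∀ {t t'} → extension t ≗ extension t' → ∀ j → rank t j ≡ rank t' j
  rank-extension {t} {t'} ext≗ext' j =
    trans (sym (toℕ-extension t j)) (trans (cong toℕ (ext≗ext' j)) (toℕ-extension t' j))

  tie-transfer : ∀ {t t'} → extension t ≗ extension t' → ∀ {w i j} → InWindow w i → InWindow w j →
                 tie t i < tie t j → tie t' i < tie t' j
  tie-transfer {t} {t'} ext≗ext' {w} {i} {j} i∈w j∈w tie< =
    +-cancelˡ-< base _ _ (subst₂ _<_ (priority-inWindow t' i∈w) (priority-inWindow t' j∈w)
      (rankBy-reflects everyone? (priority t') tt (subst₂ _<_ (rank-extension ext≗ext' i) (rank-extension ext≗ext' j)
        (rankBy-mono everyone? (priority t) tt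
          (subst₂ _<_ (sym (priority-inWindow t i∈w)) (sym (priority-inWindow t j∈w)) (+-monoʳ-< base tie<))))))
    where
    base = suc (toℕ w) * W * (n + n)

  extension-injective : ∀ {t t'} → t ∈ allPermTuples Nw size → t' ∈ allPermTuples Nw size →
                        extension t ≗ extension t' → t ≡ t'
  extension-injective {t} {t'} t∈ t'∈ ext≗ext' = component-ext λ w →
    allPerms-order-rigid (component-∈ t∈ w) (component-∈ t'∈ w) (transfer ext≗ext') (transfer (sym ∘ ext≗ext'))
    where
    transfer : ∀ {s s'} → extension s ≗ extension s' → ∀ {w} {a b : Fin (size w)} →
               lookup (component s w) a Fin.< lookup (component s w) b →
               lookup (component s' w) a Fin.< lookup (component s' w) b
    transfer {s} {s'} ext≗ {w} {a} {b} πa<πb =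
      subst₂ _<_ (tie-inWindow s' ja∈w ia≡a) (tie-inWindow s' jb∈w ib≡b) after
      where
      ja jb : Fin n
      ja = proj₁ (indexIn-surjective a)
      jb = proj₁ (indexIn-surjective b)
      ja∈w : InWindow w ja
      ja∈w = proj₁ (proj₂ (indexIn-surjective a))
      jb∈w : InWindow w jb
      jb∈w = proj₁ (proj₂ (indexIn-surjective b))
      ia≡a : indexIn ja∈w ≡ a
      ia≡a = proj₂ (proj₂ (indexIn-surjective a))
      ib≡b : indexIn jb∈w ≡ b
      ib≡b = proj₂ (proj₂ (indexIn-surjective b))
      before : tie s ja < tie s jb
      before = subst₂ _<_ (sym (tie-inWindow s ja∈w ia≡a)) (sym (tie-inWindow s jb∈w ib≡b)) πa<πb
      after : tie s' ja < tie s' jb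
      after = tie-transfer ext≗ ja∈w jb∈w before

  linearExtensions : List (Fin n → Fin n)
  linearExtensions = map extension (allPermTuples Nw size)

  linearExtensions-distinct : AllPairs (λ ρ ρ' → ¬ ρ ≗ ρ') linearExtensions
  linearExtensions-distinct = AllPairs.map⁺ (unique⇒pairwise-distinct (allPermTuples⁺ Nw size) extension-injective)

  length-linearExtensions : ∀ c → c ^ ∑[ w < Nw ] (size w ∸ c) ≤ length linearExtensions
  length-linearExtensions c = subst (c ^ ∑[ w < Nw ] (size w ∸ c) ≤_)
    (sym (length-map extension (allPermTuples Nw size))) (length-allPermTuples Nw size c)

  linearExtensions-isLinExt : ∀ {ρ} → ρ ∈ linearExtensions → IsLinExt σ ρ
  linearExtensions-isLinExt ρ∈ with ∈-map⁻ extension ρ∈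
  ... | t , t∈ , refl = extension-isLinExt t∈

  linearExtensions≢[] : linearExtensions ≢ []
  linearExtensions≢[] eq =
    <-irrefl (sym (cong length eq)) (≤-trans (m^n>0 1 (∑[ w < Nw ] (size w ∸ 1))) (length-linearExtensions 1))

  sorting-lowerBound : ∀ T → Sorts σ T → ∃[ ρ ] IsLinExt σ ρ × length linearExtensions ≤ 2 ^ cost T ρ
  sorting-lowerBound T sorts = Product.map₂ (Product.map₁ linearExtensions-isLinExt)
    (decisionTree-worstCase T linearExtensions linearExtensions≢[] linearExtensions-distinct
      (All.tabulate λ ρ∈ → sorts _ (linearExtensions-isLinExt ρ∈)))

  fewShort⇒¬fastSortable : ∀ m t .{{_ : NonZero n}} .{{_ : NonZero t}} →
    8 * shortIntervals n W σ ≤ n → 8 * (Nw * t) ≤ n → n * n ≤ t ^ 3 → ¬ FastSortable n (suc m) σ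
  fewShort⇒¬fastSortable m t 8s≤n 8Nwt≤n n²≤t³ (T , sorts , fast) =
    let ρ , isLinExt , length≤ = sorting-lowerBound T sorts in
    fastSorting-impossible {n} {m} {length linearExtensions} {cost T ρ}
      (n^2n≤len^4 {n} {t} {E} n²≤t³ enough-covered (length-linearExtensions t)) length≤ (fast ρ isLinExt)
    where
    E : ℕ
    E = ∑[ w < Nw ] (size w ∸ t)
    covered≤ : count covered? ≤ Nw * t + E
    covered≤ = subst (_≤ Nw * t + E) ∑-size (∑≤*+∑∸ size t)
    enough-covered : 3 * n ≤ 4 * E
    enough-covered = 3n≤4E {n} {count covered?} {shortIntervals n W σ} {Nw * t} {E} n≤covered+short covered≤ 8s≤n 8Nwt≤n

module Parameters (q : ℕ) where

  -- D is chosen so that fewer than U short intervals means at most n / 8 of them,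
  -- R = 16 · D so that 8 · Nw · t ≤ n, and the threshold so that n · n ≤ t ^ 3.
  D R Nw : ℕ
  D = 32 * suc q
  R = 16 * D
  Nw = 2 * D

  threshold : ℕ
  threshold = 8 * R ^ 3 + R + D

  module _ (n : ℕ) where

    W U t : ℕ
    W = suc (n / D)
    U = 2 * W * suc q
    t = n / R

    badOutcomes : List (Outcome n)
    badOutcomes = filter (λ σ → U ≤? shortIntervals n W σ) (allPerms (n + n))

    span : n + n ≤ Nw * W
    span = begin
      n + n               ≤⟨ +-mono-≤ n≤WA n≤WA ⟩
      W * D + W * D       ≡⟨ solve 2 (λ w a → w :* a :+ w :* a := con 2 :* a :* w) refl W D ⟩
      Nw * W              ∎
      where
      open ≤-Reasoning
      open +-*-Solver
      n≤WA : n ≤ W * D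
      n≤WA = <⇒≤ (m<[1+m/n]*n n D)

    8Nwt≤n : 8 * (Nw * t) ≤ n
    8Nwt≤n = ≤-trans (≤-reflexive (solve 2 (λ d t → con 8 :* (con 2 :* d :* t) := t :* (con 16 :* d)) refl D t))
                     (m/n*n≤m n R)
      where open +-*-Solver

    8s≤n : ∀ {s} → D ≤ n → s < U → 8 * s ≤ n
    8s≤n {s} D≤n s<U = *-cancelˡ-≤ 2 (begin
      2 * (8 * s)         ≤⟨ *-monoʳ-≤ 2 (*-monoʳ-≤ 8 (<⇒≤ s<U)) ⟩
      2 * (8 * U)
        ≡⟨ solve 2 (λ d q → con 2 :* (con 8 :* (con 2 :* (con 1 :+ d) :* q)) := d :* (con 32 :* q) :+ con 32 :* q)
                 refl (n / D) (suc q) ⟩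
      n / D * D + D       ≤⟨ +-mono-≤ (m/n*n≤m n D) D≤n ⟩
      n + n               ≡⟨ solve 1 (λ n → n :+ n := con 2 :* n) refl n ⟩
      2 * n               ∎)
      where
      open ≤-Reasoning
      open +-*-Solver

    module _ (threshold≤n : threshold ≤ n) where

      D≤n : D ≤ n
      D≤n = ≤-trans (m≤n+m D (8 * R ^ 3 + R)) threshold≤n

      R≤n : R ≤ n
      R≤n = ≤-trans (≤-trans (m≤n+m R (8 * R ^ 3)) (m≤m+n (8 * R ^ 3 + R) D)) threshold≤n

      8R³≤n : 8 * R ^ 3 ≤ n
      8R³≤n = ≤-trans (≤-trans (m≤m+n (8 * R ^ 3) R) (m≤m+n (8 * R ^ 3 + R) D)) threshold≤n

      instance
        n-nonZero : NonZero n
        n-nonZero = >-nonZero (<-≤-trans z<s D≤n)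

        t-nonZero : NonZero t
        t-nonZero = >-nonZero (m≥n⇒m/n>0 R≤n)

      n≤2Rt : n ≤ 2 * R * t
      n≤2Rt = begin
        n                 ≤⟨ <⇒≤ (m<[1+m/n]*n n R) ⟩
        suc t * R         ≤⟨ *-monoˡ-≤ R (+-monoˡ-≤ t (>-nonZero⁻¹ t)) ⟩
        (t + t) * R       ≡⟨ solve 2 (λ t r → (t :+ t) :* r := con 2 :* r :* t) refl t R ⟩
        2 * R * t         ∎
        where
        open ≤-Reasoning
        open +-*-Solver

      n²≤t³ : n * n ≤ t ^ 3
      n²≤t³ = *-cancelˡ-≤ (8 * R ^ 3) (begin
        8 * R ^ 3 * (n * n)                        ≤⟨ *-monoˡ-≤ (n * n) 8R³≤n ⟩
        n * (n * n)                                ≤⟨ *-mono-≤ n≤2Rt (*-mono-≤ n≤2Rt n≤2Rt) ⟩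
        2 * R * t * (2 * R * t * (2 * R * t))
          ≡⟨ solve 2 (λ r t → con 2 :* r :* t :* (con 2 :* r :* t :* (con 2 :* r :* t)) := con 8 :* r :^ 3 :* t :^ 3) refl R t ⟩
        8 * R ^ 3 * t ^ 3                          ∎)
        where
        open ≤-Reasoning
        open +-*-Solver

      length-badOutcomes : length badOutcomes * suc q ≤ (n + n) !
      length-badOutcomes = *-cancelʳ-≤ _ _ (2 * W) (begin
        length badOutcomes * suc q * (2 * W)
          ≡⟨ solve 3 (λ l q w → l :* q :* w := l :* (w :* q)) refl (length badOutcomes) (suc q) (2 * W) ⟩
        length badOutcomes * U
          ≤⟨ markov (λ σ → U ≤? shortIntervals n W σ) (shortIntervals n W) U (λ U≤s → U≤s) (allPerms (n + n)) ⟩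
        ∑[ σ ∈ allPerms (n + n) ] shortIntervals n W σ
          ≤⟨ ∑-allPerms-shortIntervals n W ⟩
        (n + n) ! * (2 * W)                      ∎)
        where
        open ≤-Reasoning
        open +-*-Solver

      fastSortable⇒bad : ∀ m σ → IsPerm n σ → FastSortable n (suc m) σ → σ ∈ badOutcomes
      fastSortable⇒bad m σ isPerm fast with U ≤? shortIntervals n W σ
      ... | yes U≤s = ∈-filter⁺ (λ σ → U ≤? shortIntervals n W σ) (∈-allPerms σ (isPerm _ _)) U≤s
      ... | no U≰s =
        ⊥-elim (Windows.fewShort⇒¬fastSortable σ W Nw span m t (8s≤n D≤n (≰⇒> U≰s)) 8Nwt≤n n²≤t³ fast)

corollary5p6p6 : (m q : ℕ) → Σ ℕ λ N → (n : ℕ) → N ≤ n →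
    Σ (List (Outcome n)) λ L → Unique L ×
      ((σ : Outcome n) → IsPerm n σ → FastSortable n (suc m) σ → σ ∈ L) ×
      (length L * suc q ≤ (n + n) !)
corollary5p6p6 m q = threshold , λ n threshold≤n →
  badOutcomes n ,
  Unique.filter⁺ _ (allPerms⁺ (n + n)) ,
  fastSortable⇒bad n threshold≤n m ,
  length-badOutcomes n threshold≤n
  where open Parameters q
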